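{- Let $n\ge1$ and let $S(1,2^n)$ be the spider with center $v_0$, one leaf $v_1$ adjacent to $v_0$, and $n$ legs $v_0-w_i-w'_i$ ($1\le i\le n$). Let $T$ be the subgraph induced on $V(S(1,2^n))\setminus\{v_1\}$, so $T\cong S(2^n)$. Suppose $\alpha:V(S(1,2^n))\to\mathbb{N}$ satisfies $\alpha|_T\in\mathcal{A}_k$ for some $k\ge2$. For $1\le j\le k$ define $\beta:V(S(1,2^n))\to\mathbb{N}$ by $\beta(v)=\phi_j(\alpha|_T)(v)$ for $v\in V(T)$ and $\beta(v_1)=\alpha(v_1)$. Then $X_{S(1,2^n)}^{\alpha}+X_{S(1,2^n)}^{\beta}\ge_{2s}0$.
   Context: $\mathbb{N}=\{0,1,2,\dots\}$. $X_G^\alpha=\sum_\kappa\prod_i x_i^{a_i}$ summed over maps $\kappa$ from $V(G)$ to finite sets of positive integers with $|\kappa(v)|=\alpha(v)$ and $\kappa(u)\cap\kappa(v)=\emptyset$ for edges $uv$, where $a_i=\#\{v:i\in\kappa(v)\}$. $f\ge_{2s}0$ means $[s_\lambda]f\ge0$ for all partitions $\lambda$ with at most two parts ($[s_\lambda]$ = Schur coefficient). For the spider $S(2^n)$ with center $v_0$ and legs $v_0-w_i-w'_i$: $\mathcal{A}_k$ is the set of maps $\gamma$ with $\gamma(v_0)=1$, $\gamma(w_i)\le1$, $\gamma(w_i)+\gamma(w'_i)\le2$ for all $i$, and $\#\{i:\gamma(w_i)=1,\gamma(w'_i)=0\}=k$; for $\gamma\in\mathcal{A}_k$ with $\{i:\gamma(w_i)=1,\gamma(w'_i)=0\}=\{i_1<\dots<i_k\}$,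 $\phi_j(\gamma)$ is the map equal to $2$ at $w_{i_j}$, $0$ at $v_0$, and $\gamma$ elsewhere. -}

module Defs where

open import Data.Nat using (ℕ; zero; suc; _+_; _≡ᵇ_; _≤_)
open import Data.Bool using (Bool; true; false; _∧_; _∨_; not; if_then_else_)
open import Data.List using (List; []; _∷_; map; concatMap; foldr; allFin; length)
open import Data.Vec using (Vec; []; _∷_; lookup)
open import Data.Fin using (Fin; zero; suc; splitAt; _≟_)
open import Data.Sum using (inj₁; inj₂)
open import Data.Maybe using (Maybe; just; nothing)
open import Data.Integer using (ℤ; +_; _-_) renaming (_+_ to _+ℤ_; _≤_ to _≤ℤ_)
open import Relation.Nullary.Decidable using (⌊_⌋)
open import Relation.Binary.PropositionalEquality using (_≡_)

allVecs : {A : Set} → List A → (N : ℕ) → List (Vec A N)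
allVecs xs zero    = [] ∷ []
allVecs xs (suc N) = concatMap (λ x → map (x ∷_) (allVecs xs N)) xs

countL : {A : Set} → (A → Bool) → List A → ℕ
countL p = foldr (λ x r → if p x then suc r else r) 0

allF : (n : ℕ) → (Fin n → Bool) → Bool
allF n p = foldr (λ i r → p i ∧ r) true (allFin n)

countF : (n : ℕ) → (Fin n → Bool) → ℕ
countF n p = countL p (allFin n)

filterL : {A : Set} → (A → Bool) → List A → List A
filterL p = foldr (λ x r → if p x then x ∷ r else r) []

-- 1-based indexing into a list
nth1 : {A : Set} → List A → ℕ → Maybe A
nth1 []       _             = nothing
nth1 (x ∷ xs) zero          = nothing
nth1 (x ∷ xs) (suc zero)    = just x
nth1 (x ∷ xs) (suc (suc j)) = nth1 xs (suc j)

record Graph : Set where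
  field
    N   : ℕ
    adj : Fin N → Fin N → Bool
open Graph public

-- A subset of {1,…,m} is a Vec Bool m (position i ↔ colour i+1).
card : {m : ℕ} → Vec Bool m → ℕ
card {m} s = countF m (λ i → lookup s i)

disjoint : {m : ℕ} → Vec Bool m → Vec Bool m → Bool
disjoint {m} s t = allF m (λ i → not (lookup s i ∧ lookup t i))

isProper : (G : Graph) → (Fin (N G) → ℕ) → {m : ℕ} → Vec (Vec Bool m) (N G) → Bool
isProper G α κ =
  allF (N G) (λ v → card (lookup κ v) ≡ᵇ α v)
  ∧ allF (N G) (λ u → allF (N G) (λ v →
      not (adj G u v) ∨ disjoint (lookup κ u) (lookup κ v)))

contentOf : (G : Graph) → {m : ℕ} → Vec (Vec Bool m) (N G) → Fin m → ℕ
contentOf G κ i = countF (N G) (λ v → lookup (lookup κ v) i)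

-- [x_1^{e_1} ⋯ x_m^{e_m}] X_G^α  (all other exponents 0):
-- the number of proper κ with values in subsets of {1..m} and content e.
monCoeff : (G : Graph) → (Fin (N G) → ℕ) → {m : ℕ} → Vec ℕ m → ℕ
monCoeff G α {m} e =
  countL (λ κ → isProper G α κ ∧ allF m (λ i → contentOf G κ i ≡ᵇ lookup e i))
         (allVecs (allVecs (true ∷ false ∷ []) m) (N G))

-- Schur coefficient [s_(a,b)] X_G^α for a partition (a,b), a ≥ b ≥ 0,
-- via the bialternant formula [s_λ] f = [x^{λ+δ}] (a_δ · f) in 2 variables:
-- [s_(a,b)] f = [x1^a x2^b] f − [x1^(a+1) x2^(b−1)] f.
schur2 : (G : Graph) → (Fin (N G) → ℕ) → ℕ → ℕ → ℤ
schur2 G α a zero    = + monCoeff G α (a ∷ 0 ∷ [])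
schur2 G α a (suc b) = + monCoeff G α (a ∷ suc b ∷ []) - + monCoeff G α (suc a ∷ b ∷ [])

SumGe2s : (G : Graph) → (Fin (N G) → ℕ) → (Fin (N G) → ℕ) → Set
SumGe2s G α β = ∀ a b → b ≤ a → + 0 ≤ℤ (schur2 G α a b +ℤ schur2 G β a b)

data SV (n : ℕ) : Set where
  v0 : SV n
  v1 : SV n
  w  : Fin n → SV n
  w' : Fin n → SV n

eqFin : {n : ℕ} → Fin n → Fin n → Bool
eqFin i j = ⌊ i ≟ j ⌋

adjSV : {n : ℕ} → SV n → SV n → Bool
adjSV v0     v1     = true
adjSV v1     v0     = true
adjSV v0     (w i)  = true
adjSV (w i)  v0     = true
adjSV (w i)  (w' j) = eqFin i j
adjSV (w' i) (w j)  = eqFin i j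
adjSV _      _      = false

-- vertex numbering: 0 ↦ v0, 1 ↦ v1, 2+i ↦ w i, 2+n+i ↦ w' i (a bijection)
decSV : (n : ℕ) → Fin (2 + (n + n)) → SV n
decSV n zero          = v0
decSV n (suc zero)    = v1
decSV n (suc (suc k)) with splitAt n k
... | inj₁ i = w i
... | inj₂ i = w' i

spider1 : ℕ → Graph
spider1 n = record { N = 2 + (n + n) ; adj = λ u v → adjSV (decSV n u) (decSV n v) }

onSpider : (n : ℕ) → (SV n → ℕ) → Fin (N (spider1 n)) → ℕ
onSpider n α u = α (decSV n u)

special : {n : ℕ} → (SV n → ℕ) → Fin n → Bool
special α i = (α (w i) ≡ᵇ 1) ∧ (α (w' i) ≡ᵇ 0)

specialList : (n : ℕ) → (SV n → ℕ) → List (Fin n)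
specialList n α = filterL (special α) (allFin n)

record InA (n : ℕ) (α : SV n → ℕ) (k : ℕ) : Set where
  field
    centre : α v0 ≡ 1
    wle1   : ∀ i → α (w i) ≤ 1
    legle2 : ∀ i → α (w i) + α (w' i) ≤ 2
    countk : length (specialList n α) ≡ k

phiExt : (n : ℕ) → (SV n → ℕ) → ℕ → SV n → ℕ
phiExt n α j v0      = 0
phiExt n α j v1      = α v1
phiExt n α j (w i)   with nth1 (specialList n α) j
... | just i' = if eqFin i' i then 2 else α (w i)
... | nothing = α (w i)
phiExt n α j (w' i)  = α (w' i)

{-# OPTIONS --safe #-}
module Submission where

-- Colour sets drawn from {1, 2} give X^γ(x₁, x₂), and a symmetric polynomial f in two variables
-- has nonnegative Schur coefficients iff [x₁^(a+1) x₂^b] f ≤ [x₁^a x₂^(b+1)] f whenever b < a.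
-- Summing over the colours of the centre and of the leaf v₁, and multiplying the contributions
-- of the legs, gives, with r, q, s the numbers of legs of α with values in {(0,2), (1,1)}, (0,1),
-- (1,1), and c = 2^s,
--   X^α + X^β = e₂^(r+1) e₁^q (x₁^m + x₂^m + c e₁^m)   if α(v₁) ≤ 1, where m = k − 1 + α(v₁),
--   X^α + X^β = c e₂^(r+2) e₁^(q+k−1)                   if α(v₁) = 2,
-- and 0 otherwise. Multiplication by e₂ and, by Pieri's rule, by e₁ preserves Schur positivity,
-- and x₁^m + x₂^m + c e₁^m is Schur positive for c ≥ 1, the only critical coefficient being
-- that of x₁^(m−1) x₂, where 1 + c ≤ c m.

open import Defs
import Algebra.Properties.CommutativeSemigroup as CommSemigroupProperties
open import Data.Bool using (Bool; true; false; _∧_; _∨_; not; if_then_else_; T)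
open import Data.Bool.Properties using (∧-zeroʳ; ∧-comm; T-∧)
open import Data.Empty using (⊥-elim)
open import Data.Fin using (Fin; zero; suc; _↑ˡ_; _↑ʳ_; splitAt)
open import Data.Fin.Properties using (splitAt-↑ˡ; splitAt-↑ʳ; splitAt⁻¹-↑ˡ; splitAt⁻¹-↑ʳ)
import Data.Fin.Properties as Fin
import Data.Integer as ℤ
import Data.Integer.Properties as ℤ
open import Data.List using (List; []; _∷_; _++_; map; concatMap; foldr; allFin; length)
open import Data.List.Properties using (foldr-map; map-tabulate)
open import Data.List.Relation.Unary.All using (All; []; _∷_)
open import Data.Maybe using (just)
open import Data.Nat using (ℕ; zero; suc; _+_; _*_; _^_; _≤_; _<_; _≡ᵇ_; s≤s; z≤n)
open import Data.Nat.GeneralisedArithmetic using (fold; fold-+)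
open import Data.Nat.Properties
open import Data.Product using (∃-syntax; _×_; _,_; proj₁; proj₂)
open import Data.Sum using (inj₁; inj₂)
open import Data.Unit using (tt)
open import Data.Vec using (Vec; []; _∷_; lookup) renaming (_++_ to _++ᵥ_)
open import Data.Vec.Properties using (lookup-++ˡ; lookup-++ʳ)
open import Function using (_∘_; id; _⇔_; Equivalence; mk⇔)
open import Relation.Binary.Bundles using (Setoid)
open import Relation.Binary.PropositionalEquality
import Relation.Binary.Reasoning.Setoid as SetoidReasoning
open import Relation.Nullary using (yes; no)
open import Relation.Nullary.Decidable using (toWitness; fromWitness; fromWitnessFalse)

open CommSemigroupProperties +-commutativeSemigroup using (x∙yz≈y∙xz; interchange)
open CommSemigroupProperties *-commutativeSemigroup using () renaming (x∙yz≈y∙xz to *-leftComm)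

private
  variable
    A B : Set
    n : ℕ

toℕ : Bool → ℕ
toℕ true  = 1
toℕ false = 0

∑ : List A → (A → ℕ) → ℕ
∑ xs g = foldr (λ x r → g x + r) 0 xs

syntax ∑ xs (λ x → e) = ∑[ x ∈ xs ] e

∑-cong : (xs : List A) {f g : A → ℕ} → (∀ x → f x ≡ g x) → ∑ xs f ≡ ∑ xs g
∑-cong []       e = refl
∑-cong (x ∷ xs) e = cong₂ _+_ (e x) (∑-cong xs e)

∑-++ : (xs ys : List A) (g : A → ℕ) → ∑ (xs ++ ys) g ≡ ∑ xs g + ∑ ys g
∑-++ []       ys g = refl
∑-++ (x ∷ xs) ys g = trans (cong (g x +_) (∑-++ xs ys g)) (sym (+-assoc (g x) _ _))

∑-zero : (xs : List A) → ∑[ x ∈ xs ] 0 ≡ 0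
∑-zero []       = refl
∑-zero (x ∷ xs) = ∑-zero xs

∑-+ : (xs : List A) (f g : A → ℕ) → ∑[ x ∈ xs ] (f x + g x) ≡ ∑ xs f + ∑ xs g
∑-+ []       f g = refl
∑-+ (x ∷ xs) f g = trans (cong (f x + g x +_) (∑-+ xs f g)) (interchange (f x) (g x) _ _)

∑-comm : (xs : List A) (ys : List B) (g : A → B → ℕ) →
         ∑[ x ∈ xs ] ∑[ y ∈ ys ] g x y ≡ ∑[ y ∈ ys ] ∑[ x ∈ xs ] g x y
∑-comm []       ys g = sym (∑-zero ys)
∑-comm (x ∷ xs) ys g = trans (cong (∑ ys (g x) +_) (∑-comm xs ys g)) (sym (∑-+ ys (g x) _))

∑-concatMap : (xs : List A) (f : A → List B) (g : B → ℕ) →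
              ∑ (concatMap f xs) g ≡ ∑[ x ∈ xs ] ∑ (f x) g
∑-concatMap []       f g = refl
∑-concatMap (x ∷ xs) f g = trans (∑-++ (f x) _ g) (cong (∑ (f x) g +_) (∑-concatMap xs f g))

∑-map : (xs : List A) (f : A → B) (g : B → ℕ) → ∑ (map f xs) g ≡ ∑ xs (g ∘ f)
∑-map []       f g = refl
∑-map (x ∷ xs) f g = cong (g (f x) +_) (∑-map xs f g)

countL-∑ : (p : A → Bool) (xs : List A) → countL p xs ≡ ∑[ x ∈ xs ] toℕ (p x)
countL-∑ p []       = refl
countL-∑ p (x ∷ xs) with p x
... | true  = cong suc (countL-∑ p xs)
... | false = countL-∑ p xs

∑-allVecs-suc : (xs : List A) (n : ℕ) (g : Vec A (suc n) → ℕ) →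
                ∑ (allVecs xs (suc n)) g ≡ ∑[ x ∈ xs ] ∑[ v ∈ allVecs xs n ] g (x ∷ v)
∑-allVecs-suc xs n g =
  trans (∑-concatMap xs _ g) (∑-cong xs (λ x → ∑-map (allVecs xs n) (x ∷_) g))

∑-allVecs-+ : (xs : List A) (m n : ℕ) (g : Vec A (m + n) → ℕ) →
              ∑ (allVecs xs (m + n)) g ≡ ∑[ u ∈ allVecs xs m ] ∑[ v ∈ allVecs xs n ] g (u ++ᵥ v)
∑-allVecs-+ xs zero    n g = sym (+-identityʳ _)
∑-allVecs-+ xs (suc m) n g =
  trans (∑-allVecs-suc xs (m + n) g)
    (trans (∑-cong xs (λ x → ∑-allVecs-+ xs m n (g ∘ (x ∷_)))) (sym (∑-allVecs-suc xs m _)))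

foldr-allFin-suc : (h : Fin (suc n) → B → B) (z : B) →
                   foldr h z (allFin (suc n)) ≡ h zero (foldr (h ∘ suc) z (allFin n))
foldr-allFin-suc {n} h z =
  cong (h zero) (trans (cong (foldr h z) (sym (map-tabulate id suc))) (foldr-map h suc z (allFin n)))

countF-suc : ∀ n (p : Fin (suc n) → Bool) → countF (suc n) p ≡ toℕ (p zero) + countF n (p ∘ suc)
countF-suc n p with p zero | foldr-allFin-suc (λ i r → if p i then suc r else r) 0
... | true  | e = e
... | false | e = e

countF-cong : ∀ n {f g : Fin n → Bool} → (∀ i → f i ≡ g i) → countF n f ≡ countF n g
countF-cong n {f} {g} e =
  trans (countL-∑ f (allFin n)) (trans (∑-cong (allFin n) (cong toℕ ∘ e)) (sym (countL-∑ g (allFin n))))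

countF-none : ∀ n (f : Fin n → Bool) → (∀ i → f i ≡ false) → countF n f ≡ 0
countF-none n f e = trans (countF-cong n e) (trans (countL-∑ _ (allFin n)) (∑-zero (allFin n)))

countF-update : ∀ n (f g : Fin n → Bool) i* → (∀ i → i* ≢ i → f i ≡ g i) →
                toℕ (f i*) + countF n g ≡ toℕ (g i*) + countF n f
countF-update (suc n) f g zero agree
  rewrite countF-suc n f | countF-suc n g | countF-cong n (λ i → agree (suc i) (λ ()))
  = x∙yz≈y∙xz (toℕ (f zero)) (toℕ (g zero)) _
countF-update (suc n) f g (suc i*) agree
  rewrite countF-suc n f | countF-suc n g | agree zero (λ ())
  = trans (x∙yz≈y∙xz (toℕ (f (suc i*))) (toℕ (g zero)) _)
      (trans (cong (toℕ (g zero) +_) (countF-update n (f ∘ suc) (g ∘ suc) i* agree′))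
             (x∙yz≈y∙xz (toℕ (g zero)) (toℕ (g (suc i*))) _))
  where
  agree′ : ∀ i → i* ≢ i → f (suc i) ≡ g (suc i)
  agree′ i i*≢i = agree (suc i) (i*≢i ∘ Fin.suc-injective)

allF-suc : ∀ n (p : Fin (suc n) → Bool) → allF (suc n) p ≡ p zero ∧ allF n (p ∘ suc)
allF-suc n p = foldr-allFin-suc (λ i r → p i ∧ r) true

T-∧⁻ : ∀ {x y} → T (x ∧ y) → T x × T y
T-∧⁻ = Equivalence.to T-∧

T-∧⁺ : ∀ {x y} → T x → T y → T (x ∧ y)
T-∧⁺ tx ty = Equivalence.from T-∧ (tx , ty)

T-ext : ∀ {x y} → (T x → T y) → (T y → T x) → x ≡ y
T-ext {true}  {true}  f g = refl
T-ext {true}  {false} f g = ⊥-elim (f tt)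
T-ext {false} {true}  f g = ⊥-elim (g tt)
T-ext {false} {false} f g = refl

T-⇒ : ∀ {x y} → T (not x ∨ y) → T x → T y
T-⇒ {true} h _ = h

T-⇐ : ∀ {x y} → (T x → T y) → T (not x ∨ y)
T-⇐ {true}  f = f tt
T-⇐ {false} f = tt

allF-elim : ∀ n (p : Fin n → Bool) → T (allF n p) → ∀ i → T (p i)
allF-elim (suc n) p h i with T-∧⁻ {p zero} (subst T (allF-suc n p) h)
allF-elim (suc n) p h zero    | h₀ , _  = h₀
allF-elim (suc n) p h (suc i) | _  , hs = allF-elim n (p ∘ suc) hs i

allF-intro : ∀ n (p : Fin n → Bool) → (∀ i → T (p i)) → T (allF n p)
allF-intro zero    p h = tt
allF-intro (suc n) p h =
  subst T (sym (allF-suc n p)) (T-∧⁺ (h zero) (allF-intro n (p ∘ suc) (h ∘ suc)))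

allF-cong : ∀ n {p q : Fin n → Bool} → (∀ i → p i ≡ q i) → allF n p ≡ allF n q
allF-cong n e = T-ext (λ h → allF-intro n _ (λ i → subst T (e i) (allF-elim n _ h i)))
                      (λ h → allF-intro n _ (λ i → subst T (sym (e i)) (allF-elim n _ h i)))

-- Polynomials in x₁, x₂, as arrays of coefficients: f a b is the coefficient of x₁^a x₂^b.

Poly : Set
Poly = ℕ → ℕ → ℕ

infix 4 _≈_
_≈_ : Poly → Poly → Set
f ≈ g = ∀ a b → f a b ≡ g a b

≈-setoid : Setoid _ _
≈-setoid = record
  { Carrier       = Poly
  ; _≈_           = _≈_
  ; isEquivalence = record
    { refl  = λ a b → refl
    ; sym   = λ e a b → sym (e a b)
    ; trans = λ e e′ a b → trans (e a b) (e′ a b)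
    }
  }

open Setoid ≈-setoid public using () renaming (refl to ≈-refl; sym to ≈-sym; trans to ≈-trans)
module ≈-Reasoning = SetoidReasoning ≈-setoid

≈-reindex : (G : ℕ → Poly) {m m′ : ℕ} → m ≡ m′ → G m ≈ G m′
≈-reindex G e a b = cong (λ z → G z a b) e

≈-reindex₃ : (G : ℕ → ℕ → ℕ → Poly) {x x′ y y′ z z′ : ℕ} →
             x ≡ x′ → y ≡ y′ → z ≡ z′ → G x y z ≈ G x′ y′ z′
≈-reindex₃ G refl refl refl = ≈-refl

0ₚ 𝟙 : Poly
0ₚ _ _ = 0
𝟙 zero    zero    = 1
𝟙 zero    (suc b) = 0
𝟙 (suc a) b       = 0

infixl 6 _⊕_
infixl 7 _⊛_
infixr 8 x₁*_ x₂*_ e₁*_ e₂*_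
infixr 9 _^[_]_

_⊕_ : Poly → Poly → Poly
(f ⊕ g) a b = f a b + g a b

_⊛_ : ℕ → Poly → Poly
(c ⊛ f) a b = c * f a b

x₁*_ x₂*_ e₁*_ e₂*_ : Poly → Poly
(x₁* f) zero    b       = 0
(x₁* f) (suc a) b       = f a b
(x₂* f) a       zero    = 0
(x₂* f) a       (suc b) = f a b
e₁* f = x₁* f ⊕ x₂* f
e₂* f = x₁* x₂* f

_^[_]_ : (Poly → Poly) → ℕ → Poly → Poly
F ^[ n ] f = fold f F n

⊕-cong : {f f′ g g′ : Poly} → f ≈ f′ → g ≈ g′ → f ⊕ g ≈ f′ ⊕ g′
⊕-cong e e′ a b = cong₂ _+_ (e a b) (e′ a b)

x₁x₂-comm : ∀ f → x₁* x₂* f ≈ x₂* x₁* f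
x₁x₂-comm f zero    zero    = refl
x₁x₂-comm f zero    (suc b) = refl
x₁x₂-comm f (suc a) zero    = refl
x₁x₂-comm f (suc a) (suc b) = refl

-- Operators that behave like multiplication by a fixed polynomial.
record IsMultiplier (F : Poly → Poly) : Set where
  field
    resp-≈  : {f g : Poly} → f ≈ g → F f ≈ F g
    ⊕-homo  : ∀ f g → F (f ⊕ g) ≈ F f ⊕ F g
    ⊛-homo  : ∀ c f → F (c ⊛ f) ≈ c ⊛ F f
    x₁-comm : ∀ f → F (x₁* f) ≈ x₁* F f
    x₂-comm : ∀ f → F (x₂* f) ≈ x₂* F f

  0ₚ-homo : F 0ₚ ≈ 0ₚ
  0ₚ-homo = ≈-trans (resp-≈ {0ₚ} {0 ⊛ 0ₚ} ≈-refl) (⊛-homo 0 0ₚ)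

  e₁-comm : ∀ f → F (e₁* f) ≈ e₁* F f
  e₁-comm f = ≈-trans (⊕-homo _ _) (⊕-cong (x₁-comm f) (x₂-comm f))

open IsMultiplier

x₁-isMultiplier : IsMultiplier x₁*_
x₁-isMultiplier = record
  { resp-≈  = λ { e zero b → refl ; e (suc a) b → e a b }
  ; ⊕-homo  = λ { f g zero b → refl ; f g (suc a) b → refl }
  ; ⊛-homo  = λ { c f zero b → sym (*-zeroʳ c) ; c f (suc a) b → refl }
  ; x₁-comm = λ f → ≈-refl
  ; x₂-comm = x₁x₂-comm
  }

x₂-isMultiplier : IsMultiplier x₂*_
x₂-isMultiplier = record
  { resp-≈  = λ { e a zero → refl ; e a (suc b) → e a b }
  ; ⊕-homo  = λ { f g a zero → refl ; f g a (suc b) → refl }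
  ; ⊛-homo  = λ { c f a zero → sym (*-zeroʳ c) ; c f a (suc b) → refl }
  ; x₁-comm = λ f → ≈-sym (x₁x₂-comm f)
  ; x₂-comm = λ f → ≈-refl
  }

id-isMultiplier : IsMultiplier id
id-isMultiplier = record
  { resp-≈  = id
  ; ⊕-homo  = λ _ _ → ≈-refl
  ; ⊛-homo  = λ _ _ → ≈-refl
  ; x₁-comm = λ _ → ≈-refl
  ; x₂-comm = λ _ → ≈-refl
  }

0-isMultiplier : IsMultiplier (λ _ → 0ₚ)
0-isMultiplier = record
  { resp-≈  = λ _ → ≈-refl
  ; ⊕-homo  = λ _ _ → ≈-refl
  ; ⊛-homo  = λ c _ a b → sym (*-zeroʳ c)
  ; x₁-comm = λ { f zero b → refl ; f (suc a) b → refl }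
  ; x₂-comm = λ { f a zero → refl ; f a (suc b) → refl }
  }

⊛-isMultiplier : ∀ c → IsMultiplier (c ⊛_)
⊛-isMultiplier c = record
  { resp-≈  = λ e a b → cong (c *_) (e a b)
  ; ⊕-homo  = λ f g a b → *-distribˡ-+ c (f a b) (g a b)
  ; ⊛-homo  = λ d f a b → *-leftComm c d (f a b)
  ; x₁-comm = λ { f zero b → *-zeroʳ c ; f (suc a) b → refl }
  ; x₂-comm = λ { f a zero → *-zeroʳ c ; f a (suc b) → refl }
  }

∘-isMultiplier : {F G : Poly → Poly} → IsMultiplier F → IsMultiplier G → IsMultiplier (F ∘ G)
∘-isMultiplier {F} {G} mF mG = record
  { resp-≈  = resp-≈ mF ∘ resp-≈ mG
  ; ⊕-homo  = λ f g → ≈-trans (resp-≈ mF (⊕-homo mG f g)) (⊕-homo mF (G f) (G g))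
  ; ⊛-homo  = λ c f → ≈-trans (resp-≈ mF (⊛-homo mG c f)) (⊛-homo mF c (G f))
  ; x₁-comm = λ f → ≈-trans (resp-≈ mF (x₁-comm mG f)) (x₁-comm mF (G f))
  ; x₂-comm = λ f → ≈-trans (resp-≈ mF (x₂-comm mG f)) (x₂-comm mF (G f))
  }

⊕-isMultiplier : {F G : Poly → Poly} → IsMultiplier F → IsMultiplier G →
                 IsMultiplier (λ f → F f ⊕ G f)
⊕-isMultiplier {F} {G} mF mG = record
  { resp-≈  = λ e → ⊕-cong (resp-≈ mF e) (resp-≈ mG e)
  ; ⊕-homo  = λ f g a b → trans (cong₂ _+_ (⊕-homo mF f g a b) (⊕-homo mG f g a b))
                                (interchange (F f a b) (F g a b) _ _)
  ; ⊛-homo  = λ c f a b → trans (cong₂ _+_ (⊛-homo mF c f a b) (⊛-homo mG c f a b))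
                                (sym (*-distribˡ-+ c (F f a b) _))
  ; x₁-comm = λ f → ≈-trans (⊕-cong (x₁-comm mF f) (x₁-comm mG f))
                            (≈-sym (⊕-homo x₁-isMultiplier (F f) (G f)))
  ; x₂-comm = λ f → ≈-trans (⊕-cong (x₂-comm mF f) (x₂-comm mG f))
                            (≈-sym (⊕-homo x₂-isMultiplier (F f) (G f)))
  }

^-isMultiplier : {F : Poly → Poly} → IsMultiplier F → ∀ n → IsMultiplier (F ^[ n ]_)
^-isMultiplier mF zero    = id-isMultiplier
^-isMultiplier mF (suc n) = ∘-isMultiplier mF (^-isMultiplier mF n)

e₁-isMultiplier : IsMultiplier e₁*_
e₁-isMultiplier = ⊕-isMultiplier x₁-isMultiplier x₂-isMultiplier

e₂-isMultiplier : IsMultiplier e₂*_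
e₂-isMultiplier = ∘-isMultiplier x₁-isMultiplier x₂-isMultiplier

e₂-comm : {F : Poly → Poly} → IsMultiplier F → ∀ f → F (e₂* f) ≈ e₂* F f
e₂-comm mF f = ≈-trans (x₁-comm mF _) (resp-≈ x₁-isMultiplier (x₂-comm mF f))

Σₚ : List A → (A → Poly) → Poly
Σₚ xs F a b = ∑[ x ∈ xs ] F x a b

syntax Σₚ xs (λ x → e) = Σₚ[ x ∈ xs ] e

Σₚ-pull : {G : Poly → Poly} {F K : A → Poly} → IsMultiplier G → (xs : List A) →
          (∀ x → F x ≈ G (K x)) → Σₚ xs F ≈ G (Σₚ xs K)
Σₚ-pull mG []       e = ≈-sym (0ₚ-homo mG)
Σₚ-pull mG (x ∷ xs) e = ≈-trans (⊕-cong (e x) (Σₚ-pull mG xs e)) (≈-sym (⊕-homo mG _ _))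

Σₚ-cong : (xs : List A) {F K : A → Poly} → (∀ x → F x ≈ K x) → Σₚ xs F ≈ Σₚ xs K
Σₚ-cong xs = Σₚ-pull id-isMultiplier xs

Symmetric : Poly → Set
Symmetric f = ∀ a b → f a b ≡ f b a

-- For symmetric f, the bialternant formula of schur2 gives [s_(a,b+1)] f = f a (b+1) − f (a+1) b.
record SchurPositive (f : Poly) : Set where
  field
    symmetric : Symmetric f
    dominance : ∀ a b → b < a → f (suc a) b ≤ f a (suc b)

open SchurPositive

SchurPositive-resp : {f g : Poly} → f ≈ g → SchurPositive f → SchurPositive g
SchurPositive-resp e sp = record
  { symmetric = λ a b → trans (sym (e a b)) (trans (symmetric sp a b) (e b a))
  ; dominance = λ a b h → subst₂ _≤_ (e (suc a) b) (e a (suc b)) (dominance sp a b h)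
  }

𝟙-symmetric : Symmetric 𝟙
𝟙-symmetric zero    zero    = refl
𝟙-symmetric zero    (suc b) = refl
𝟙-symmetric (suc a) zero    = refl
𝟙-symmetric (suc a) (suc b) = refl

𝟙-schurPositive : SchurPositive 𝟙
𝟙-schurPositive = record { symmetric = 𝟙-symmetric ; dominance = λ _ _ _ → z≤n }

⊛-schurPositive : ∀ c {f} → SchurPositive f → SchurPositive (c ⊛ f)
⊛-schurPositive c sf = record
  { symmetric = λ a b → cong (c *_) (symmetric sf a b)
  ; dominance = λ a b h → *-monoʳ-≤ c (dominance sf a b h)
  }

x₁-flip : {f : Poly} → Symmetric f → ∀ a b → (x₁* f) a b ≡ (x₂* f) b a
x₁-flip sf zero    b = refl
x₁-flip sf (suc a) b = sf a b

e₂-schurPositive : {f : Poly} → SchurPositive f → SchurPositive (e₂* f)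
e₂-schurPositive {f} sf = record { symmetric = sym-e₂ ; dominance = dom-e₂ }
  where
  sym-e₂ : Symmetric (e₂* f)
  sym-e₂ zero    zero    = refl
  sym-e₂ zero    (suc b) = refl
  sym-e₂ (suc a) zero    = refl
  sym-e₂ (suc a) (suc b) = symmetric sf a b

  dom-e₂ : ∀ a b → b < a → (e₂* f) (suc a) b ≤ (e₂* f) a (suc b)
  dom-e₂ a       zero    _         = z≤n
  dom-e₂ (suc a) (suc b) (s≤s b<a) = dominance sf a b b<a

-- Pieri's rule for e₁ = s₁; symmetry of f settles the boundary case a ≡ b + 1.
e₁-schurPositive : {f : Poly} → SchurPositive f → SchurPositive (e₁* f)
e₁-schurPositive {f} sf = record { symmetric = sym-e₁ ; dominance = dom-e₁ }
  where
  sym-e₁ : Symmetric (e₁* f)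
  sym-e₁ a b = trans (cong₂ _+_ (x₁-flip (symmetric sf) a b) (sym (x₁-flip (symmetric sf) b a)))
                     (+-comm ((x₂* f) b a) _)

  x₂≤x₁ : ∀ a b → b < a → (x₂* f) (suc a) b ≤ (x₁* f) a (suc b)
  x₂≤x₁ a zero _ = z≤n
  x₂≤x₁ (suc a) (suc b) (s≤s b<a) with m≤n⇒m<n∨m≡n b<a
  ... | inj₁ 1+b<a = ≤-trans (dominance sf (suc a) b (m<n⇒m<1+n b<a)) (dominance sf a (suc b) 1+b<a)
  ... | inj₂ refl  = ≤-trans (dominance sf (suc a) b (m<n⇒m<1+n b<a)) (≤-reflexive (symmetric sf _ _))

  dom-e₁ : ∀ a b → b < a → (e₁* f) (suc a) b ≤ (e₁* f) a (suc b)
  dom-e₁ a b b<a = subst (_≤ (e₁* f) a (suc b)) (+-comm ((x₂* f) (suc a) b) (f a b))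
                     (+-monoˡ-≤ (f a b) (x₂≤x₁ a b b<a))

^-schurPositive : {F : Poly → Poly} → (∀ {f} → SchurPositive f → SchurPositive (F f)) →
                  ∀ n {f} → SchurPositive f → SchurPositive (F ^[ n ] f)
^-schurPositive pF zero    sf = sf
^-schurPositive pF (suc n) sf = pF (^-schurPositive pF n sf)

x₂^-flip : ∀ m {f} → Symmetric f → ∀ a b → (x₂*_ ^[ m ] f) a b ≡ (x₁*_ ^[ m ] f) b a
x₂^-flip zero    sf a b       = sf a b
x₂^-flip (suc m) sf a zero    = refl
x₂^-flip (suc m) sf a (suc b) = x₂^-flip m sf a b

x₂^𝟙-vanish : ∀ m a b → (x₂*_ ^[ m ] 𝟙) (suc a) b ≡ 0
x₂^𝟙-vanish zero    a b       = refl
x₂^𝟙-vanish (suc m) a zero    = refl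
x₂^𝟙-vanish (suc m) a (suc b) = x₂^𝟙-vanish m a b

x₁^𝟙-vanish : ∀ m a b → (x₁*_ ^[ m ] 𝟙) a (suc b) ≡ 0
x₁^𝟙-vanish m a b = trans (sym (x₂^-flip m 𝟙-symmetric (suc b) a)) (x₂^𝟙-vanish m b a)

x₁^𝟙-diagonal : ∀ m → (x₁*_ ^[ m ] 𝟙) m 0 ≡ 1
x₁^𝟙-diagonal zero    = refl
x₁^𝟙-diagonal (suc m) = x₁^𝟙-diagonal m

x₁^𝟙-offDiagonal : ∀ m a → m ≢ a → (x₁*_ ^[ m ] 𝟙) a 0 ≡ 0
x₁^𝟙-offDiagonal zero    zero    m≢a = ⊥-elim (m≢a refl)
x₁^𝟙-offDiagonal zero    (suc a) m≢a = refl
x₁^𝟙-offDiagonal (suc m) zero    m≢a = refl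
x₁^𝟙-offDiagonal (suc m) (suc a) m≢a = x₁^𝟙-offDiagonal m a (m≢a ∘ cong suc)

e₁^𝟙-corner : ∀ m → (e₁*_ ^[ m ] 𝟙) m 0 ≡ 1
e₁^𝟙-corner zero    = refl
e₁^𝟙-corner (suc m) = trans (+-identityʳ _) (e₁^𝟙-corner m)

e₁^𝟙-nextToCorner : ∀ a → (e₁*_ ^[ suc a ] 𝟙) a 1 ≡ suc a
e₁^𝟙-nextToCorner zero    = refl
e₁^𝟙-nextToCorner (suc a) =
  trans (cong₂ _+_ (e₁^𝟙-nextToCorner a) (e₁^𝟙-corner (suc a))) (+-comm (suc a) 1)

powerPoly : ℕ → ℕ → Poly
powerPoly m c = x₂*_ ^[ m ] 𝟙 ⊕ x₁*_ ^[ m ] 𝟙 ⊕ c ⊛ e₁*_ ^[ m ] 𝟙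

powerPoly-schurPositive : ∀ m {c} → 1 ≤ c → SchurPositive (powerPoly m c)
powerPoly-schurPositive m {c} 1≤c = record { symmetric = sym-p ; dominance = dom-p }
  where
  X₁ X₂ E : Poly
  X₁ = x₁*_ ^[ m ] 𝟙
  X₂ = x₂*_ ^[ m ] 𝟙
  E  = e₁*_ ^[ m ] 𝟙

  sE : SchurPositive E
  sE = ^-schurPositive e₁-schurPositive m 𝟙-schurPositive

  sym-p : Symmetric (powerPoly m c)
  sym-p a b = cong₂ _+_
    (trans (cong₂ _+_ (x₂^-flip m 𝟙-symmetric a b) (sym (x₂^-flip m 𝟙-symmetric b a)))
           (+-comm (X₁ b a) _))
    (cong (c *_) (symmetric sE a b))

  1+c≤c*[2+a] : ∀ a → 1 + c * 1 ≤ c * suc (suc a)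
  1+c≤c*[2+a] a = begin
    1 + c * 1       ≡⟨ +-comm 1 (c * 1) ⟩
    c * 1 + 1       ≤⟨ +-mono-≤ (*-monoʳ-≤ c (s≤s z≤n)) 1≤c ⟩
    c * suc a + c   ≡⟨ +-comm _ c ⟩
    c + c * suc a   ≡⟨ *-suc c (suc a) ⟨
    c * suc (suc a) ∎
    where open ≤-Reasoning

  corner : ∀ a b → b < a → X₁ (suc a) b + c * E (suc a) b ≤ c * E a (suc b)
  corner a (suc b) b<a rewrite x₁^𝟙-vanish m (suc a) b =
    *-monoʳ-≤ c (dominance sE a (suc b) b<a)
  corner a zero    0<a with m ≟ suc a
  ... | no m≢1+a rewrite x₁^𝟙-offDiagonal m (suc a) m≢1+a =
    *-monoʳ-≤ c (dominance sE a 0 0<a)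
  corner (suc a) zero 0<a | yes refl
    rewrite x₁^𝟙-diagonal (suc (suc a)) | e₁^𝟙-corner (suc (suc a)) | e₁^𝟙-nextToCorner (suc a)
    = 1+c≤c*[2+a] a

  dom-p : ∀ a b → b < a → powerPoly m c (suc a) b ≤ powerPoly m c a (suc b)
  dom-p a b b<a = begin
    X₂ (suc a) b + X₁ (suc a) b + c * E (suc a) b
      ≡⟨ cong (λ z → z + X₁ (suc a) b + c * E (suc a) b) (x₂^𝟙-vanish m a b) ⟩
    X₁ (suc a) b + c * E (suc a) b
      ≤⟨ corner a b b<a ⟩
    c * E a (suc b)
      ≤⟨ m≤n+m _ _ ⟩
    X₂ a (suc b) + X₁ a (suc b) + c * E a (suc b) ∎
    where open ≤-Reasoning



ColourSet : Set
ColourSet = Vec Bool 2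

colourSets : List ColourSet
colourSets = allVecs (true ∷ false ∷ []) 2

x^ : ColourSet → Poly → Poly
x^ (b₁ ∷ b₂ ∷ []) f = x₁*_ ^[ toℕ b₁ ] x₂*_ ^[ toℕ b₂ ] f

x^-isMultiplier : ∀ c → IsMultiplier (x^ c)
x^-isMultiplier (b₁ ∷ b₂ ∷ []) =
  ∘-isMultiplier (^-isMultiplier x₁-isMultiplier (toℕ b₁)) (^-isMultiplier x₂-isMultiplier (toℕ b₂))

guardedShift : Bool → ColourSet → ColourSet → Poly → Poly
guardedShift o c c′ f = if o then x^ c (x^ c′ f) else 0ₚ

guardedShift-isMultiplier : ∀ o c c′ → IsMultiplier (guardedShift o c c′)
guardedShift-isMultiplier true  c c′ = ∘-isMultiplier (x^-isMultiplier c) (x^-isMultiplier c′)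
guardedShift-isMultiplier false c c′ = 0-isMultiplier

-- [P] x₁^i x₂^j; the trailing ∧ true is how allF 2 unfolds in monCoeff.
monomialIf : Bool → ℕ → ℕ → Poly
monomialIf P i j a b = toℕ (P ∧ ((i ≡ᵇ a) ∧ ((j ≡ᵇ b) ∧ true)))

monomialIf-cong : ∀ {P P′ i i′ j j′} → P ≡ P′ → i ≡ i′ → j ≡ j′ →
                  monomialIf P i j ≈ monomialIf P′ i′ j′
monomialIf-cong refl refl refl = ≈-refl

monomialIf-x₁ : ∀ P i j → monomialIf P (suc i) j ≈ x₁* monomialIf P i j
monomialIf-x₁ P i j zero    b = cong toℕ (∧-zeroʳ P)
monomialIf-x₁ P i j (suc a) b = refl

monomialIf-x₂ : ∀ P i j → monomialIf P i (suc j) ≈ x₂* monomialIf P i j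
monomialIf-x₂ P i j a zero    = cong toℕ (trans (cong (P ∧_) (∧-zeroʳ (i ≡ᵇ a))) (∧-zeroʳ P))
monomialIf-x₂ P i j a (suc b) = refl

monomialIf-shift : ∀ P m n i j → monomialIf P (m + i) (n + j) ≈ x₁*_ ^[ m ] x₂*_ ^[ n ] monomialIf P i j
monomialIf-shift P zero    zero    i j = ≈-refl
monomialIf-shift P zero    (suc n) i j =
  ≈-trans (monomialIf-x₂ P i (n + j)) (resp-≈ x₂-isMultiplier (monomialIf-shift P zero n i j))
monomialIf-shift P (suc m) n       i j =
  ≈-trans (monomialIf-x₁ P (m + i) (n + j)) (resp-≈ x₁-isMultiplier (monomialIf-shift P m n i j))

monomialIf-guardedShift : ∀ o P i j (c c′ : ColourSet) →
  monomialIf (o ∧ P) (toℕ (lookup c zero) + (toℕ (lookup c′ zero) + i))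
                     (toℕ (lookup c (suc zero)) + (toℕ (lookup c′ (suc zero)) + j))
  ≈ guardedShift o c c′ (monomialIf P i j)
monomialIf-guardedShift false P i j c c′ = ≈-refl
monomialIf-guardedShift true  P i j (b₁ ∷ b₂ ∷ []) (d₁ ∷ d₂ ∷ []) =
  ≈-trans (monomialIf-shift P (toℕ b₁) (toℕ b₂) (toℕ d₁ + i) (toℕ d₂ + j))
          (resp-≈ (x^-isMultiplier (b₁ ∷ b₂ ∷ [])) (monomialIf-shift P (toℕ d₁) (toℕ d₂) i j))

#colour : Fin 2 → Vec ColourSet n → ℕ
#colour k []      = 0
#colour k (c ∷ u) = toℕ (lookup c k) + #colour k u

pairSum : (Vec ColourSet n → Vec ColourSet n → Poly) → Poly
pairSum {n} F = Σₚ[ u ∈ allVecs colourSets n ] Σₚ[ u′ ∈ allVecs colourSets n ] F u u′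

pairSum-pull : {G : Poly → Poly} {F H : Vec ColourSet n → Vec ColourSet n → Poly} → IsMultiplier G →
               (∀ u u′ → F u u′ ≈ G (H u u′)) → pairSum F ≈ G (pairSum H)
pairSum-pull {n} mG e =
  Σₚ-pull mG (allVecs colourSets n) (λ u → Σₚ-pull mG (allVecs colourSets n) (e u))

pairSum-cong : {F H : Vec ColourSet n → Vec ColourSet n → Poly} →
               (∀ u u′ → F u u′ ≈ H u u′) → pairSum F ≈ pairSum H
pairSum-cong = pairSum-pull id-isMultiplier

pairSum-guardedShift : ∀ o (P : Vec ColourSet n → Vec ColourSet n → Bool)
                         (I J : Vec ColourSet n → Vec ColourSet n → ℕ) c c′ →
  pairSum (λ u u′ → monomialIf (o ∧ P u u′) (toℕ (lookup c zero) + (toℕ (lookup c′ zero) + I u u′))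
                                            (toℕ (lookup c (suc zero)) + (toℕ (lookup c′ (suc zero)) + J u u′)))
  ≈ guardedShift o c c′ (pairSum (λ u u′ → monomialIf (P u u′) (I u u′) (J u u′)))
pairSum-guardedShift o P I J c c′ = pairSum-pull (guardedShift-isMultiplier o c c′)
  (λ u u′ → monomialIf-guardedShift o (P u u′) (I u u′) (J u u′) c c′)

legOK : ColourSet → ℕ → ℕ → ColourSet → ColourSet → Bool
legOK c₀ p q x x′ = (card x ≡ᵇ p) ∧ ((card x′ ≡ᵇ q) ∧ (disjoint c₀ x ∧ disjoint x x′))

legsOK : ColourSet → (Fin n → ℕ) → (Fin n → ℕ) → Vec ColourSet n → Vec ColourSet n → Bool
legsOK c₀ p q []      []        = true
legsOK c₀ p q (x ∷ u) (x′ ∷ u′) =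
  legOK c₀ (p zero) (q zero) x x′ ∧ legsOK c₀ (p ∘ suc) (q ∘ suc) u u′

legContent : Fin 2 → Vec ColourSet n → Vec ColourSet n → ℕ
legContent k u u′ = #colour k u + #colour k u′

legsPoly : ColourSet → (Fin n → ℕ) → (Fin n → ℕ) → Poly
legsPoly c₀ p q =
  pairSum λ u u′ → monomialIf (legsOK c₀ p q u u′) (legContent zero u u′) (legContent (suc zero) u u′)

legFactor : ColourSet → ℕ → ℕ → Poly → Poly
legFactor c₀ p q f =
  Σₚ[ x ∈ colourSets ] Σₚ[ x′ ∈ colourSets ] guardedShift (legOK c₀ p q x x′) x x′ f

legFactor-resp : ∀ c₀ p q {f g} → f ≈ g → legFactor c₀ p q f ≈ legFactor c₀ p q g
legFactor-resp c₀ p q e = Σₚ-cong colourSets λ x → Σₚ-cong colourSets λ x′ →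
  resp-≈ (guardedShift-isMultiplier (legOK c₀ p q x x′) x x′) e

legsPoly-zero : ∀ c₀ (p q : Fin 0 → ℕ) → legsPoly c₀ p q ≈ 𝟙
legsPoly-zero c₀ p q zero    zero    = refl
legsPoly-zero c₀ p q zero    (suc b) = refl
legsPoly-zero c₀ p q (suc a) b       = refl

legsPoly-suc : ∀ c₀ (p q : Fin (suc n) → ℕ) →
               legsPoly c₀ p q ≈ legFactor c₀ (p zero) (q zero) (legsPoly c₀ (p ∘ suc) (q ∘ suc))
legsPoly-suc {n} c₀ p q a b = begin
  ∑[ v ∈ vecs (suc n) ] ∑[ v′ ∈ vecs (suc n) ] L v v′ a b
    ≡⟨ ∑-allVecs-suc colourSets n (λ v → ∑[ v′ ∈ vecs (suc n) ] L v v′ a b) ⟩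
  ∑[ x ∈ colourSets ] ∑[ u ∈ vecs n ] ∑[ v′ ∈ vecs (suc n) ] L (x ∷ u) v′ a b
    ≡⟨ ∑-cong colourSets (λ x → ∑-cong (vecs n) λ u → ∑-allVecs-suc colourSets n (λ v′ → L (x ∷ u) v′ a b)) ⟩
  ∑[ x ∈ colourSets ] ∑[ u ∈ vecs n ] ∑[ x′ ∈ colourSets ] ∑[ u′ ∈ vecs n ] L (x ∷ u) (x′ ∷ u′) a b
    ≡⟨ ∑-cong colourSets (λ x → ∑-comm (vecs n) colourSets λ u x′ → ∑[ u′ ∈ vecs n ] L (x ∷ u) (x′ ∷ u′) a b) ⟩
  ∑[ x ∈ colourSets ] ∑[ x′ ∈ colourSets ] ∑[ u ∈ vecs n ] ∑[ u′ ∈ vecs n ] L (x ∷ u) (x′ ∷ u′) a b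
    ≡⟨ ∑-cong colourSets (λ x → ∑-cong colourSets (λ x′ → firstLeg x x′)) ⟩
  legFactor c₀ (p zero) (q zero) (legsPoly c₀ (p ∘ suc) (q ∘ suc)) a b ∎
  where
  open ≡-Reasoning
  vecs : ∀ m → List (Vec ColourSet m)
  vecs = allVecs colourSets

  L : Vec ColourSet (suc n) → Vec ColourSet (suc n) → Poly
  L v v′ = monomialIf (legsOK c₀ p q v v′) (legContent zero v v′) (legContent (suc zero) v v′)

  rearrange : ∀ x A y B → (x + A) + (y + B) ≡ x + (y + (A + B))
  rearrange x A y B = trans (+-assoc x A (y + B)) (cong (x +_) (x∙yz≈y∙xz A y B))

  firstLeg : ∀ x x′ →
    pairSum (λ u u′ → L (x ∷ u) (x′ ∷ u′)) a b
    ≡ guardedShift (legOK c₀ (p zero) (q zero) x x′) x x′ (legsPoly c₀ (p ∘ suc) (q ∘ suc)) a b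
  firstLeg x x′ = trans
    (pairSum-cong {n} (λ u u′ → monomialIf-cong {legsOK c₀ p q (x ∷ u) (x′ ∷ u′)} refl
       (rearrange (toℕ (lookup x zero)) (#colour zero u) (toℕ (lookup x′ zero)) (#colour zero u′))
       (rearrange (toℕ (lookup x (suc zero))) (#colour (suc zero) u)
                  (toℕ (lookup x′ (suc zero))) (#colour (suc zero) u′)))
       a b)
    (pairSum-guardedShift {n} (legOK c₀ (p zero) (q zero) x x′) (legsOK c₀ (p ∘ suc) (q ∘ suc))
                              (legContent zero) (legContent (suc zero)) x x′ a b)

legsOK-elim : ∀ c₀ (p q : Fin n → ℕ) u u′ → T (legsOK c₀ p q u u′) →
              ∀ i → T (legOK c₀ (p i) (q i) (lookup u i) (lookup u′ i))
legsOK-elim c₀ p q (x ∷ u) (x′ ∷ u′) h zero    = proj₁ (T-∧⁻ h)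
legsOK-elim c₀ p q (x ∷ u) (x′ ∷ u′) h (suc i) =
  legsOK-elim c₀ (p ∘ suc) (q ∘ suc) u u′ (proj₂ (T-∧⁻ h)) i

legsOK-intro : ∀ c₀ (p q : Fin n → ℕ) u u′ →
               (∀ i → T (legOK c₀ (p i) (q i) (lookup u i) (lookup u′ i))) → T (legsOK c₀ p q u u′)
legsOK-intro c₀ p q []      []        h = tt
legsOK-intro c₀ p q (x ∷ u) (x′ ∷ u′) h =
  T-∧⁺ (h zero) (legsOK-intro c₀ (p ∘ suc) (q ∘ suc) u u′ (h ∘ suc))

disjoint-sym : ∀ (s t : ColourSet) → disjoint s t ≡ disjoint t s
disjoint-sym (x ∷ y ∷ []) (x′ ∷ y′ ∷ []) rewrite ∧-comm x x′ | ∧-comm y y′ = refl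

colouring : ColourSet → ColourSet → Vec ColourSet n → Vec ColourSet n → SV n → ColourSet
colouring c₀ c₁ u u′ v0     = c₀
colouring c₀ c₁ u u′ v1     = c₁
colouring c₀ c₁ u u′ (w i)  = lookup u i
colouring c₀ c₁ u u′ (w' i) = lookup u′ i

lookup-spider : ∀ c₀ c₁ (u u′ : Vec ColourSet n) k →
                lookup (c₀ ∷ c₁ ∷ (u ++ᵥ u′)) k ≡ colouring c₀ c₁ u u′ (decSV n k)
lookup-spider c₀ c₁ u u′ zero          = refl
lookup-spider c₀ c₁ u u′ (suc zero)    = refl
lookup-spider {n} c₀ c₁ u u′ (suc (suc k)) with splitAt n k in eq
... | inj₁ i = trans (cong (lookup (u ++ᵥ u′)) (sym (splitAt⁻¹-↑ˡ eq))) (lookup-++ˡ u u′ i)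
... | inj₂ i = trans (cong (lookup (u ++ᵥ u′)) (sym (splitAt⁻¹-↑ʳ eq))) (lookup-++ʳ u u′ i)

encSV : SV n → Fin (2 + (n + n))
encSV     v0     = zero
encSV     v1     = suc zero
encSV {n} (w i)  = suc (suc (i ↑ˡ n))
encSV {n} (w' i) = suc (suc (n ↑ʳ i))

decSV-encSV : ∀ v → decSV n (encSV v) ≡ v
decSV-encSV     v0     = refl
decSV-encSV     v1     = refl
decSV-encSV {n} (w i)  rewrite splitAt-↑ˡ n i n = refl
decSV-encSV {n} (w' i) rewrite splitAt-↑ʳ n n i = refl

centreOK : ℕ → ℕ → ColourSet → ColourSet → Bool
centreOK p₀ p₁ c₀ c₁ = (card c₀ ≡ᵇ p₀) ∧ ((card c₁ ≡ᵇ p₁) ∧ disjoint c₀ c₁)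

module _ (γ : SV n → ℕ) (col : SV n → ColourSet) where

  vertexTest : SV n → Bool
  vertexTest v = card (col v) ≡ᵇ γ v

  edgeTest : SV n → SV n → Bool
  edgeTest x y = not (adjSV x y) ∨ disjoint (col x) (col y)

  ProperOnSpider : Set
  ProperOnSpider = (∀ v → T (vertexTest v)) × (∀ x y → T (adjSV x y) → T (disjoint (col x) (col y)))

  vertexTests edgeTests spiderTests : Bool
  vertexTests = allF (N (spider1 n)) (vertexTest ∘ decSV n)
  edgeTests   = allF (N (spider1 n)) (λ k → allF (N (spider1 n)) (λ l → edgeTest (decSV n k) (decSV n l)))
  spiderTests = vertexTests ∧ edgeTests

  spiderTests⇔proper : T spiderTests ⇔ ProperOnSpider
  spiderTests⇔proper = mk⇔ to from
    where
    to : T spiderTests → ProperOnSpider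
    to h = vertex , edge
      where
      vertex : ∀ v → T (vertexTest v)
      vertex v = subst (T ∘ vertexTest) (decSV-encSV v)
        (allF-elim _ (vertexTest ∘ decSV n) (proj₁ (T-∧⁻ {vertexTests} {edgeTests} h)) (encSV v))
      edge : ∀ x y → T (adjSV x y) → T (disjoint (col x) (col y))
      edge x y = T-⇒ (subst₂ (λ x y → T (edgeTest x y)) (decSV-encSV x) (decSV-encSV y)
                        (allF-elim _ (λ l → edgeTest (decSV n (encSV x)) (decSV n l))
                          (allF-elim _ (λ k → allF _ (λ l → edgeTest (decSV n k) (decSV n l)))
                             (proj₂ (T-∧⁻ {vertexTests} {edgeTests} h)) (encSV x)) (encSV y)))
    from : ProperOnSpider → T spiderTests
    from (vertex , edge) =
      T-∧⁺ {vertexTests} {edgeTests} (allF-intro _ _ (vertex ∘ decSV n))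
           (allF-intro _ _ (λ k → allF-intro _ _ (λ l → T-⇐ (edge (decSV n k) (decSV n l)))))

module _ (γ : SV n → ℕ) (c₀ c₁ : ColourSet) (u u′ : Vec ColourSet n) where

  private
    col : SV n → ColourSet
    col = colouring c₀ c₁ u u′

  isProper-spiderTests : isProper (spider1 n) (onSpider n γ) (c₀ ∷ c₁ ∷ (u ++ᵥ u′)) ≡ spiderTests γ col
  isProper-spiderTests = cong₂ _∧_
    (allF-cong _ (λ k → cong (λ c → card c ≡ᵇ γ (decSV n k)) (lookup-spider c₀ c₁ u u′ k)))
    (allF-cong _ (λ k → allF-cong _ (λ l →
       cong₂ (λ c c′ → not (adjSV (decSV n k) (decSV n l)) ∨ disjoint c c′)
             (lookup-spider c₀ c₁ u u′ k) (lookup-spider c₀ c₁ u u′ l))))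

  centreAndLegs : Bool
  centreAndLegs = centreOK (γ v0) (γ v1) c₀ c₁ ∧ legsOK c₀ (γ ∘ w) (γ ∘ w') u u′

  proper⇒centreAndLegs : ProperOnSpider γ col → T centreAndLegs
  proper⇒centreAndLegs (vertex , edge) =
    T-∧⁺ (T-∧⁺ (vertex v0) (T-∧⁺ (vertex v1) (edge v0 v1 tt)))
         (legsOK-intro c₀ (γ ∘ w) (γ ∘ w') u u′ (λ i →
           T-∧⁺ (vertex (w i)) (T-∧⁺ (vertex (w' i))
             (T-∧⁺ (edge v0 (w i) tt) (edge (w i) (w' i) (fromWitness refl))))))

  centreAndLegs⇒proper : T centreAndLegs → ProperOnSpider γ col
  centreAndLegs⇒proper h = vertex , edge
    where
    centre : T (card c₀ ≡ᵇ γ v0) × T (card c₁ ≡ᵇ γ v1) × T (disjoint c₀ c₁)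
    centre = let (h₁ , h′) = T-∧⁻ {card c₀ ≡ᵇ γ v0} (proj₁ (T-∧⁻ {centreOK (γ v0) (γ v1) c₀ c₁} h))
                 (h₂ , h₃) = T-∧⁻ h′
             in h₁ , h₂ , h₃
    legs : ∀ i → T (legOK c₀ (γ (w i)) (γ (w' i)) (lookup u i) (lookup u′ i))
    legs = legsOK-elim c₀ (γ ∘ w) (γ ∘ w') u u′ (proj₂ (T-∧⁻ {centreOK (γ v0) (γ v1) c₀ c₁} h))

    leg : ∀ i → T (card (lookup u i) ≡ᵇ γ (w i)) × T (card (lookup u′ i) ≡ᵇ γ (w' i))
              × T (disjoint c₀ (lookup u i)) × T (disjoint (lookup u i) (lookup u′ i))
    leg i = let (h₁ , h′) = T-∧⁻ (legs i) ; (h₂ , h″) = T-∧⁻ h′ ; (h₃ , h₄) = T-∧⁻ h″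
            in h₁ , h₂ , h₃ , h₄

    vertex : ∀ v → T (vertexTest γ col v)
    vertex v0     = proj₁ centre
    vertex v1     = proj₁ (proj₂ centre)
    vertex (w i)  = proj₁ (leg i)
    vertex (w' i) = proj₁ (proj₂ (leg i))

    flip : ∀ s t → T (disjoint s t) → T (disjoint t s)
    flip s t = subst T (disjoint-sym s t)

    edge : ∀ x y → T (adjSV x y) → T (disjoint (col x) (col y))
    edge v0     v1     _ = proj₂ (proj₂ centre)
    edge v1     v0     _ = flip c₀ c₁ (edge v0 v1 tt)
    edge v0     (w i)  _ = proj₁ (proj₂ (proj₂ (leg i)))
    edge (w i)  v0     _ = flip c₀ (lookup u i) (edge v0 (w i) tt)
    edge (w i)  (w' j) a with toWitness a
    ... | refl = proj₂ (proj₂ (proj₂ (leg i)))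
    edge (w' i) (w j)  a with toWitness a
    ... | refl = flip (lookup u i) (lookup u′ i) (proj₂ (proj₂ (proj₂ (leg i))))
    edge v0     v0     ()
    edge v0     (w' i) ()
    edge v1     v1     ()
    edge v1     (w i)  ()
    edge v1     (w' i) ()
    edge (w i)  v1     ()
    edge (w i)  (w j)  ()
    edge (w' i) v0     ()
    edge (w' i) v1     ()
    edge (w' i) (w' j) ()

  isProper-spider : isProper (spider1 n) (onSpider n γ) (c₀ ∷ c₁ ∷ (u ++ᵥ u′)) ≡ centreAndLegs
  isProper-spider = trans isProper-spiderTests
    (T-ext (proper⇒centreAndLegs ∘ Equivalence.to (spiderTests⇔proper γ col))
           (Equivalence.from (spiderTests⇔proper γ col) ∘ centreAndLegs⇒proper))

countF-lookup : ∀ {m} (κ : Vec ColourSet m) k → countF m (λ v → lookup (lookup κ v) k) ≡ #colour k κ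
countF-lookup         []      k = refl
countF-lookup {suc m} (c ∷ κ) k = trans (countF-suc m _) (cong (toℕ (lookup c k) +_) (countF-lookup κ k))

#colour-++ : ∀ {m} (u : Vec ColourSet m) (u′ : Vec ColourSet n) k →
             #colour k (u ++ᵥ u′) ≡ #colour k u + #colour k u′
#colour-++ []      u′ k = refl
#colour-++ (c ∷ u) u′ k =
  trans (cong (toℕ (lookup c k) +_) (#colour-++ u u′ k)) (sym (+-assoc (toℕ (lookup c k)) _ _))

contentOf-spider : ∀ c₀ c₁ (u u′ : Vec ColourSet n) k →
  contentOf (spider1 n) (c₀ ∷ c₁ ∷ (u ++ᵥ u′)) k
  ≡ toℕ (lookup c₀ k) + (toℕ (lookup c₁ k) + legContent k u u′)
contentOf-spider c₀ c₁ u u′ k = trans (countF-lookup (c₀ ∷ c₁ ∷ (u ++ᵥ u′)) k)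
  (cong (λ z → toℕ (lookup c₀ k) + (toℕ (lookup c₁ k) + z)) (#colour-++ u u′ k))

centreLeaf : ℕ → ℕ → (ColourSet → Poly) → Poly
centreLeaf p₀ p₁ L =
  Σₚ[ c₀ ∈ colourSets ] Σₚ[ c₁ ∈ colourSets ] guardedShift (centreOK p₀ p₁ c₀ c₁) c₀ c₁ (L c₀)

spiderX : (n : ℕ) → (SV n → ℕ) → Poly
spiderX n γ a b = monCoeff (spider1 n) (onSpider n γ) (a ∷ b ∷ [])

spiderX-decomposition : ∀ n (γ : SV n → ℕ) →
  spiderX n γ ≈ centreLeaf (γ v0) (γ v1) (λ c₀ → legsPoly c₀ (γ ∘ w) (γ ∘ w'))
spiderX-decomposition n γ a b = begin
  spiderX n γ a b
    ≡⟨ countL-∑ _ (vecs (2 + (n + n))) ⟩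
  ∑[ κ ∈ vecs (2 + (n + n)) ] M κ
    ≡⟨ ∑-allVecs-suc colourSets (suc (n + n)) M ⟩
  ∑[ c₀ ∈ colourSets ] ∑[ v ∈ vecs (suc (n + n)) ] M (c₀ ∷ v)
    ≡⟨ ∑-cong colourSets (λ c₀ → ∑-allVecs-suc colourSets (n + n) (M ∘ (c₀ ∷_))) ⟩
  ∑[ c₀ ∈ colourSets ] ∑[ c₁ ∈ colourSets ] ∑[ v ∈ vecs (n + n) ] M (c₀ ∷ c₁ ∷ v)
    ≡⟨ ∑-cong colourSets (λ c₀ → ∑-cong colourSets λ c₁ → ∑-allVecs-+ colourSets n n (M ∘ (c₀ ∷_) ∘ (c₁ ∷_))) ⟩
  ∑[ c₀ ∈ colourSets ] ∑[ c₁ ∈ colourSets ] pairSum {n} (λ u u′ → termAt (c₀ ∷ c₁ ∷ (u ++ᵥ u′))) a b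
    ≡⟨ ∑-cong colourSets (λ c₀ → ∑-cong colourSets (λ c₁ → centreAndLegsSum c₀ c₁)) ⟩
  centreLeaf (γ v0) (γ v1) (λ c₀ → legsPoly c₀ (γ ∘ w) (γ ∘ w')) a b ∎
  where
  open ≡-Reasoning
  vecs : ∀ m → List (Vec ColourSet m)
  vecs = allVecs colourSets

  termAt : Vec ColourSet (2 + (n + n)) → Poly
  termAt κ = monomialIf (isProper (spider1 n) (onSpider n γ) κ)
                  (contentOf (spider1 n) κ zero) (contentOf (spider1 n) κ (suc zero))

  M : Vec ColourSet (2 + (n + n)) → ℕ
  M κ = termAt κ a b

  centreAndLegsSum : ∀ c₀ c₁ → pairSum {n} (λ u u′ → termAt (c₀ ∷ c₁ ∷ (u ++ᵥ u′))) a b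
    ≡ guardedShift (centreOK (γ v0) (γ v1) c₀ c₁) c₀ c₁ (legsPoly c₀ (γ ∘ w) (γ ∘ w')) a b
  centreAndLegsSum c₀ c₁ = trans
    (pairSum-cong {n} (λ u u′ → monomialIf-cong (isProper-spider γ c₀ c₁ u u′)
       (contentOf-spider c₀ c₁ u u′ zero) (contentOf-spider c₀ c₁ u u′ (suc zero))) a b)
    (pairSum-guardedShift {n} (centreOK (γ v0) (γ v1) c₀ c₁) (legsOK c₀ (γ ∘ w) (γ ∘ w'))
                              (legContent zero) (legContent (suc zero)) c₀ c₁ a b)

Tally : Set
Tally = ℕ → ℕ → ℕ

infix 4 _≐_
_≐_ : Tally → Tally → Set
t ≐ t′ = ∀ p q → t p q ≡ t′ p q

tally : (Fin n → ℕ) → (Fin n → ℕ) → Tally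
tally {n} p q p′ q′ = countF n (λ i → (p i ≡ᵇ p′) ∧ (q i ≡ᵇ q′))

tick : ℕ → ℕ → Tally → Tally
tick p q t p′ q′ = toℕ ((p ≡ᵇ p′) ∧ (q ≡ᵇ q′)) + t p′ q′

tally-suc : (p q : Fin (suc n) → ℕ) → tally p q ≐ tick (p zero) (q zero) (tally (p ∘ suc) (q ∘ suc))
tally-suc {n} p q p′ q′ = countF-suc n _

tally-update : ∀ (p p′ q : Fin n → ℕ) i* → (∀ i → i* ≢ i → p i ≡ p′ i) →
               tick (p i*) (q i*) (tally p′ q) ≐ tick (p′ i*) (q i*) (tally p q)
tally-update {n} p p′ q i* agree x y =
  countF-update n _ _ i* (λ i i*≢i → cong (λ z → (z ≡ᵇ x) ∧ (q i ≡ᵇ y)) (agree i i*≢i))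

tick-cong : ∀ {p p′ q q′} → p ≡ p′ → q ≡ q′ → ∀ t → tick p q t ≐ tick p′ q′ t
tick-cong refl refl t x y = refl

legsPoly-normalForm : ∀ c₀ (F : Tally → Poly) →
  (∀ {t t′} → t ≐ t′ → F t ≈ F t′) → F (λ _ _ → 0) ≈ 𝟙 →
  (Ok : ℕ → ℕ → Set) → (∀ {p q} → Ok p q → ∀ t → legFactor c₀ p q (F t) ≈ F (tick p q t)) →
  (p q : Fin n → ℕ) → (∀ i → Ok (p i) (q i)) → legsPoly c₀ p q ≈ F (tally p q)
legsPoly-normalForm {zero}  c₀ F F-resp F-𝟙 Ok step p q ok = ≈-trans (legsPoly-zero c₀ p q) (≈-sym F-𝟙)
legsPoly-normalForm {suc n} c₀ F F-resp F-𝟙 Ok step p q ok = begin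
  legsPoly c₀ p q                                                  ≈⟨ legsPoly-suc c₀ p q ⟩
  legFactor c₀ (p zero) (q zero) (legsPoly c₀ (p ∘ suc) (q ∘ suc)) ≈⟨ legFactor-resp c₀ (p zero) (q zero) tail ⟩
  legFactor c₀ (p zero) (q zero) (F (tally (p ∘ suc) (q ∘ suc)))   ≈⟨ step (ok zero) _ ⟩
  F (tick (p zero) (q zero) (tally (p ∘ suc) (q ∘ suc)))           ≈⟨ F-resp (≐-sym (tally-suc p q)) ⟩
  F (tally p q)                                                    ∎
  where
  open ≈-Reasoning
  ≐-sym : ∀ {t t′} → t ≐ t′ → t′ ≐ t
  ≐-sym e p′ q′ = sym (e p′ q′)
  tail : legsPoly c₀ (p ∘ suc) (q ∘ suc) ≈ F (tally (p ∘ suc) (q ∘ suc))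
  tail = legsPoly-normalForm c₀ F F-resp F-𝟙 Ok step (p ∘ suc) (q ∘ suc) (ok ∘ suc)

only₁ only₂ none : ColourSet
only₁ = true  ∷ false ∷ []
only₂ = false ∷ true  ∷ []
none  = false ∷ false ∷ []

data Leg : ℕ → ℕ → Set where
  leg00 : Leg 0 0
  leg01 : Leg 0 1
  leg02 : Leg 0 2
  leg10 : Leg 1 0
  leg11 : Leg 1 1
  leg20 : Leg 2 0

eMul : ℕ → ℕ → Poly → Poly
eMul r s f = e₂*_ ^[ r ] e₁*_ ^[ s ] f

eMul-isMultiplier : ∀ r s → IsMultiplier (eMul r s)
eMul-isMultiplier r s = ∘-isMultiplier (^-isMultiplier e₂-isMultiplier r) (^-isMultiplier e₁-isMultiplier s)

eMul-e₁ : ∀ r s f → e₁* eMul r s f ≈ eMul r (suc s) f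
eMul-e₁ r s f = ≈-sym (e₁-comm (^-isMultiplier e₂-isMultiplier r) _)

eMul-e₂ : ∀ r r′ s f → r′ ≡ suc r → e₂* eMul r s f ≈ eMul r′ s f
eMul-e₂ r r′ s f r′≡1+r = ≈-reindex (λ r → eMul r s f) (sym r′≡1+r)

scaledE : ℕ → ℕ → ℕ → Poly
scaledE c y x = c ⊛ eMul y x 𝟙

scaledE-e₁ : ∀ c y x → e₁* scaledE c y x ≈ scaledE c y (suc x)
scaledE-e₁ c y x = ≈-trans (⊛-homo e₁-isMultiplier c _) (resp-≈ (⊛-isMultiplier c) (eMul-e₁ y x 𝟙))

scaledE-e₂ : ∀ c y x → e₂* scaledE c y x ≈ scaledE c (suc y) x
scaledE-e₂ c y x = ⊛-homo e₂-isMultiplier c _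

scaledE-2e₂ : ∀ c y x → e₂* scaledE c y x ⊕ e₂* scaledE c y x ≈ scaledE (2 * c) (suc y) x
scaledE-2e₂ c y x a b = begin
  (e₂* scaledE c y x) a b + (e₂* scaledE c y x) a b ≡⟨ cong₂ _+_ (scaledE-e₂ c y x a b) (scaledE-e₂ c y x a b) ⟩
  c * E a b + c * E a b                             ≡⟨ cong (λ d → c * E a b + d * E a b) (+-identityʳ c) ⟨
  c * E a b + (c + 0) * E a b                       ≡⟨ *-distribʳ-+ (E a b) c (c + 0) ⟨
  (2 * c) * E a b                                   ∎
  where
  open ≡-Reasoning
  E : Poly
  E = eMul (suc y) x 𝟙

e₂-degree : Tally → ℕ
e₂-degree t = t 0 2 + t 1 1

-- A leg with values (0,0), (0,1), (0,2), (1,1) contributes 1, e₁, e₂, e₂ (2 e₂ if the centre is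
-- uncoloured); a (1,0)-leg contributes x₂, x₁ or e₁ when the centre is coloured {1}, {2} or ∅,
-- and a (2,0)-leg, possible only with an uncoloured centre, contributes e₂.
legsForm₁ legsForm₂ legsForm∅ : Tally → Poly
legsForm₁ t = eMul (e₂-degree t) (t 0 1) (x₂*_ ^[ t 1 0 ] 𝟙)
legsForm₂ t = eMul (e₂-degree t) (t 0 1) (x₁*_ ^[ t 1 0 ] 𝟙)
legsForm∅ t = scaledE (2 ^ t 1 1) (t 2 0 + e₂-degree t) (t 0 1 + t 1 0)

-- Sums over colourSets end in + 0, and the excluded colour sets contribute further zeros.
x+0+0≡x : ∀ x → x + 0 + 0 ≡ x
x+0+0≡x x = trans (+-identityʳ (x + 0)) (+-identityʳ x)

x+[y+0]+0≡x+y : ∀ x y → x + (y + 0) + 0 ≡ x + y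
x+[y+0]+0≡x+y x y = trans (+-identityʳ _) (cong (x +_) (+-identityʳ y))

x+0+[y+0+0]≡x+y : ∀ x y → x + 0 + (y + 0 + 0) ≡ x + y
x+0+[y+0+0]≡x+y x y = cong₂ _+_ (+-identityʳ x) (x+0+0≡x y)

legsForm₁-step : ∀ {p q} → Leg p q × p ≤ 1 → ∀ t →
                 legFactor only₁ p q (legsForm₁ t) ≈ legsForm₁ (tick p q t)
legsForm₁-step (l , p≤1) t = step l p≤1
  where
  r s : ℕ
  r = e₂-degree t
  s = t 0 1
  g : Poly
  g = x₂*_ ^[ t 1 0 ] 𝟙
  step : ∀ {p q} → Leg p q → p ≤ 1 → legFactor only₁ p q (eMul r s g) ≈ legsForm₁ (tick p q t)
  step leg00 _ a b = x+0+0≡x _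
  step leg01 _     = ≈-trans (λ a b → x+[y+0]+0≡x+y ((x₁* eMul r s g) a b) ((x₂* eMul r s g) a b))
                             (eMul-e₁ r s g)
  step leg02 _ a b = x+0+0≡x _
  step leg10 _     = ≈-trans (λ a b → x+0+0≡x _) (≈-sym (x₂-comm (eMul-isMultiplier r s) g))
  step leg11 _     = ≈-trans (λ a b → x+0+0≡x _)
                       (≈-trans (≈-sym (x₁x₂-comm _)) (eMul-e₂ r _ s g (+-suc (t 0 2) (t 1 1))))
  step leg20 (s≤s ())

legsForm₂-step : ∀ {p q} → Leg p q × p ≤ 1 → ∀ t →
                 legFactor only₂ p q (legsForm₂ t) ≈ legsForm₂ (tick p q t)
legsForm₂-step (l , p≤1) t = step l p≤1
  where
  r s : ℕ
  r = e₂-degree t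
  s = t 0 1
  g : Poly
  g = x₁*_ ^[ t 1 0 ] 𝟙
  step : ∀ {p q} → Leg p q → p ≤ 1 → legFactor only₂ p q (eMul r s g) ≈ legsForm₂ (tick p q t)
  step leg00 _ a b = x+0+0≡x _
  step leg01 _     = ≈-trans (λ a b → x+[y+0]+0≡x+y ((x₁* eMul r s g) a b) ((x₂* eMul r s g) a b))
                             (eMul-e₁ r s g)
  step leg02 _ a b = x+0+0≡x _
  step leg10 _     = ≈-trans (λ a b → x+0+0≡x _) (≈-sym (x₁-comm (eMul-isMultiplier r s) g))
  step leg11 _     = ≈-trans (λ a b → x+0+0≡x _) (eMul-e₂ r _ s g (+-suc (t 0 2) (t 1 1)))
  step leg20 (s≤s ())

legsForm∅-step : ∀ {p q} → Leg p q → ∀ t → legFactor none p q (legsForm∅ t) ≈ legsForm∅ (tick p q t)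
legsForm∅-step l t = step l
  where
  c y x : ℕ
  c = 2 ^ t 1 1
  y = t 2 0 + e₂-degree t
  x = t 0 1 + t 1 0
  F : Poly
  F = scaledE c y x
  step : ∀ {p q} → Leg p q → legFactor none p q F ≈ legsForm∅ (tick p q t)
  step leg00 a b = x+0+0≡x _
  step leg01 = ≈-trans (λ a b → x+[y+0]+0≡x+y ((x₁* F) a b) ((x₂* F) a b)) (scaledE-e₁ c y x)
  step leg02 = ≈-trans (λ a b → x+0+0≡x _)
    (≈-trans (scaledE-e₂ c y x) (≈-reindex (λ y′ → scaledE c y′ x) (sym (+-suc (t 2 0) (e₂-degree t)))))
  step leg10 = ≈-trans (λ a b → x+0+[y+0+0]≡x+y ((x₁* F) a b) ((x₂* F) a b))
    (≈-trans (scaledE-e₁ c y x) (≈-reindex (scaledE c y) (sym (+-suc (t 0 1) (t 1 0)))))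
  step leg11 = ≈-trans (λ a b → x+0+[y+0+0]≡x+y ((e₂* F) a b) ((x₂* x₁* F) a b))
    (≈-trans (⊕-cong ≈-refl (≈-sym (x₁x₂-comm F)))
      (≈-trans (scaledE-2e₂ c y x) (≈-reindex (λ y′ → scaledE (2 * c) y′ x)
        (sym (trans (cong (t 2 0 +_) (+-suc (t 0 2) (t 1 1))) (+-suc (t 2 0) (e₂-degree t)))))))
  step leg20 = ≈-trans (λ a b → x+0+0≡x _) (scaledE-e₂ c y x)

legsPoly-only₁ : (p q : Fin n → ℕ) → (∀ i → Leg (p i) (q i) × p i ≤ 1) →
                 legsPoly only₁ p q ≈ legsForm₁ (tally p q)
legsPoly-only₁ = legsPoly-normalForm only₁ legsForm₁
  (λ e → ≈-reindex₃ (λ r s k → eMul r s (x₂*_ ^[ k ] 𝟙)) (cong₂ _+_ (e 0 2) (e 1 1)) (e 0 1) (e 1 0))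
  ≈-refl (λ p q → Leg p q × p ≤ 1) legsForm₁-step

legsPoly-only₂ : (p q : Fin n → ℕ) → (∀ i → Leg (p i) (q i) × p i ≤ 1) →
                 legsPoly only₂ p q ≈ legsForm₂ (tally p q)
legsPoly-only₂ = legsPoly-normalForm only₂ legsForm₂
  (λ e → ≈-reindex₃ (λ r s k → eMul r s (x₁*_ ^[ k ] 𝟙)) (cong₂ _+_ (e 0 2) (e 1 1)) (e 0 1) (e 1 0))
  ≈-refl (λ p q → Leg p q × p ≤ 1) legsForm₂-step

legsPoly-none : (p q : Fin n → ℕ) → (∀ i → Leg (p i) (q i)) → legsPoly none p q ≈ legsForm∅ (tally p q)
legsPoly-none = legsPoly-normalForm none legsForm∅
  (λ e → ≈-reindex₃ scaledE (cong (2 ^_) (e 1 1)) (cong₂ _+_ (e 2 0) (cong₂ _+_ (e 0 2) (e 1 1)))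
                             (cong₂ _+_ (e 0 1) (e 1 0)))
  (λ a b → +-identityʳ _) Leg legsForm∅-step

centreLeaf-1-0 : ∀ L → centreLeaf 1 0 L ≈ x₁* L only₁ ⊕ x₂* L only₂
centreLeaf-1-0 L a b = x+0+[y+0+0]≡x+y ((x₁* L only₁) a b) ((x₂* L only₂) a b)

centreLeaf-1-1 : ∀ L → centreLeaf 1 1 L ≈ e₂* L only₁ ⊕ x₂* x₁* L only₂
centreLeaf-1-1 L a b = x+0+[y+0+0]≡x+y ((e₂* L only₁) a b) ((x₂* x₁* L only₂) a b)

centreLeaf-1-2+ : ∀ e L → centreLeaf 1 (2 + e) L ≈ 0ₚ
centreLeaf-1-2+ zero    L = ≈-refl
centreLeaf-1-2+ (suc e) L = ≈-refl

centreLeaf-0-0 : ∀ L → centreLeaf 0 0 L ≈ L none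
centreLeaf-0-0 L a b = x+0+0≡x _

centreLeaf-0-1 : ∀ L → centreLeaf 0 1 L ≈ e₁* L none
centreLeaf-0-1 L a b = x+[y+0]+0≡x+y ((x₁* L none) a b) ((x₂* L none) a b)

centreLeaf-0-2 : ∀ L → centreLeaf 0 2 L ≈ e₂* L none
centreLeaf-0-2 L a b = x+0+0≡x _

centreLeaf-0-3+ : ∀ e L → centreLeaf 0 (3 + e) L ≈ 0ₚ
centreLeaf-0-3+ e L = ≈-refl

eMul-schurPositive : ∀ r s {f} → SchurPositive f → SchurPositive (eMul r s f)
eMul-schurPositive r s = ^-schurPositive e₂-schurPositive r ∘ ^-schurPositive e₁-schurPositive s

⊛-e₂-eMul : ∀ c r s g → c ⊛ e₂* eMul r s g ≈ eMul r s (e₂* (c ⊛ g))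
⊛-e₂-eMul c r s g = begin
  c ⊛ e₂* eMul r s g     ≈⟨ resp-≈ (⊛-isMultiplier c) (e₂-comm (eMul-isMultiplier r s) g) ⟨
  c ⊛ eMul r s (e₂* g)   ≈⟨ ⊛-homo (eMul-isMultiplier r s) c _ ⟨
  eMul r s (c ⊛ e₂* g)   ≈⟨ resp-≈ (eMul-isMultiplier r s) (⊛-homo e₂-isMultiplier c g) ⟨
  eMul r s (e₂* (c ⊛ g)) ∎
  where open ≈-Reasoning

eMul-e₂-powerPoly : ∀ r s m c →
  eMul r s (e₂* x₂*_ ^[ m ] 𝟙) ⊕ eMul r s (e₂* x₁*_ ^[ m ] 𝟙) ⊕ c ⊛ e₂* eMul r s (e₁*_ ^[ m ] 𝟙)
  ≈ eMul r s (e₂* powerPoly m c)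
eMul-e₂-powerPoly r s m c = begin
  K (x₂*_ ^[ m ] 𝟙) ⊕ K (x₁*_ ^[ m ] 𝟙) ⊕ c ⊛ e₂* eMul r s (e₁*_ ^[ m ] 𝟙)
    ≈⟨ ⊕-cong ≈-refl (⊛-e₂-eMul c r s _) ⟩
  K (x₂*_ ^[ m ] 𝟙) ⊕ K (x₁*_ ^[ m ] 𝟙) ⊕ K (c ⊛ e₁*_ ^[ m ] 𝟙)
    ≈⟨ ⊕-cong (⊕-homo K-isMultiplier _ _) ≈-refl ⟨
  K (x₂*_ ^[ m ] 𝟙 ⊕ x₁*_ ^[ m ] 𝟙) ⊕ K (c ⊛ e₁*_ ^[ m ] 𝟙)
    ≈⟨ ⊕-homo K-isMultiplier _ _ ⟨
  K (powerPoly m c) ∎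
  where
  open ≈-Reasoning
  K : Poly → Poly
  K f = eMul r s (e₂* f)
  K-isMultiplier : IsMultiplier K
  K-isMultiplier = ∘-isMultiplier (eMul-isMultiplier r s) e₂-isMultiplier

leg-of : ∀ {p q} → p ≤ 1 → p + q ≤ 2 → Leg p q
leg-of {0}           {0}                 _        _              = leg00
leg-of {0}           {1}                 _        _              = leg01
leg-of {0}           {2}                 _        _              = leg02
leg-of {0}           {suc (suc (suc q))} _        (s≤s (s≤s ()))
leg-of {1}           {0}                 _        _              = leg10
leg-of {1}           {1}                 _        _              = leg11
leg-of {1}           {suc (suc q)}       _        (s≤s (s≤s ()))
leg-of {suc (suc p)} {q}                 (s≤s ()) _

≡ᵇ2-false : ∀ {p} → p ≤ 1 → ∀ q → (p ≡ᵇ 2) ∧ q ≡ false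
≡ᵇ2-false {0}           _        q = refl
≡ᵇ2-false {1}           _        q = refl
≡ᵇ2-false {suc (suc p)} (s≤s ()) q

filterL-all : (p : A → Bool) (xs : List A) → All (T ∘ p) (filterL p xs)
filterL-all p []       = []
filterL-all p (x ∷ xs) with p x in eq
... | true  = subst T (sym eq) _ ∷ filterL-all p xs
... | false = filterL-all p xs

nth1-All : ∀ {P : A → Set} (xs : List A) j → All P xs → 1 ≤ j → j ≤ length xs →
           ∃[ x ] nth1 xs j ≡ just x × P x
nth1-All (x ∷ xs) 1             (px ∷ _)   _ _        = x , refl , px
nth1-All (x ∷ xs) (suc (suc j)) (_  ∷ pxs) _ (s≤s j≤) = nth1-All xs (suc j) pxs (s≤s z≤n) j≤

if-true : ∀ {b} {x y : A} → T b → (if b then x else y) ≡ x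
if-true {b = true} _ = refl

if-false : ∀ {b} {x y : A} → T (not b) → (if b then x else y) ≡ y
if-false {b = false} _ = refl

module SpecialLeg {n : ℕ} {α : SV n → ℕ} {k : ℕ} (α∈𝒜ₖ : InA n α k)
                  {j : ℕ} (1≤j : 1 ≤ j) (j≤k : j ≤ k) where

  open InA α∈𝒜ₖ

  β : SV n → ℕ
  β = phiExt n α j

  αw αw′ βw : Fin n → ℕ
  αw  = α ∘ w
  αw′ = α ∘ w'
  βw  = β ∘ w

  jth : ∃[ i ] nth1 (specialList n α) j ≡ just i × T (special α i)
  jth = nth1-All (specialList n α) j (filterL-all (special α) (allFin n)) 1≤j
                 (subst (j ≤_) (sym countk) j≤k)

  i* : Fin n
  i* = proj₁ jth

  αw-i* : αw i* ≡ 1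
  αw-i* = ≡ᵇ⇒≡ _ 1 (proj₁ (T-∧⁻ (proj₂ (proj₂ jth))))

  αw′-i* : αw′ i* ≡ 0
  αw′-i* = ≡ᵇ⇒≡ _ 0 (proj₂ (T-∧⁻ {αw i* ≡ᵇ 1} (proj₂ (proj₂ jth))))

  βw-if : ∀ i → βw i ≡ (if eqFin i* i then 2 else αw i)
  βw-if i rewrite proj₁ (proj₂ jth) = refl

  βw-i* : βw i* ≡ 2
  βw-i* = trans (βw-if i*) (if-true (fromWitness {a? = i* Fin.≟ i*} refl))

  βw-off : ∀ {i} → i* ≢ i → βw i ≡ αw i
  βw-off {i} i*≢i = trans (βw-if i) (if-false (fromWitnessFalse {a? = i* Fin.≟ i} i*≢i))

  legs-α : ∀ i → Leg (αw i) (αw′ i) × αw i ≤ 1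
  legs-α i = leg-of (wle1 i) (legle2 i) , wle1 i

  legs-β : ∀ i → Leg (βw i) (αw′ i)
  legs-β i with i* Fin.≟ i
  ... | yes refl = subst₂ Leg (sym βw-i*) (sym αw′-i*) leg20
  ... | no i*≢i  = subst (λ p → Leg p (αw′ i)) (sym (βw-off i*≢i)) (proj₁ (legs-α i))

  t t′ : Tally
  t  = tally αw αw′
  t′ = tally βw αw′

  t′-update : tick 1 0 t′ ≐ tick 2 0 t
  t′-update x y = begin
    tick 1 0 t′ x y              ≡⟨ tick-cong αw-i* αw′-i* t′ x y ⟨
    tick (αw i*) (αw′ i*) t′ x y ≡⟨ tally-update αw βw αw′ i* (λ i → sym ∘ βw-off) x y ⟩
    tick (βw i*) (αw′ i*) t x y  ≡⟨ tick-cong βw-i* αw′-i* t x y ⟩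
    tick 2 0 t x y               ∎
    where open ≡-Reasoning

  -- m = k − 1, the number of (1,0)-legs of β
  m : ℕ
  m = t′ 1 0

  t-10 : t 1 0 ≡ suc m
  t-10 = sym (t′-update 1 0)

  t-20 : t 2 0 ≡ 0
  t-20 = countF-none n _ (λ i → ≡ᵇ2-false (wle1 i) _)

  r s c : ℕ
  r = e₂-degree t
  s = t 0 1
  c = 2 ^ t 1 1

  E : Poly → Poly
  E = eMul r s

  E-isMultiplier : IsMultiplier E
  E-isMultiplier = eMul-isMultiplier r s

  Lα Lβ : ColourSet → Poly
  Lα c₀ = legsPoly c₀ αw αw′
  Lβ c₀ = legsPoly c₀ βw αw′

  Lα-only₁ : Lα only₁ ≈ E (x₂*_ ^[ suc m ] 𝟙)
  Lα-only₁ = ≈-trans (legsPoly-only₁ αw αw′ legs-α) (≈-reindex (λ l → E (x₂*_ ^[ l ] 𝟙)) t-10)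

  Lα-only₂ : Lα only₂ ≈ E (x₁*_ ^[ suc m ] 𝟙)
  Lα-only₂ = ≈-trans (legsPoly-only₂ αw αw′ legs-α) (≈-reindex (λ l → E (x₁*_ ^[ l ] 𝟙)) t-10)

  Lβ-none : Lβ none ≈ c ⊛ e₂* E (e₁*_ ^[ m ] 𝟙)
  Lβ-none = ≈-trans (legsPoly-none βw αw′ legs-β)
    (≈-trans (≈-reindex₃ scaledE (cong (2 ^_) (t′-update 1 1))
                (cong₂ _+_ (trans (t′-update 2 0) (cong suc t-20)) (cong₂ _+_ (t′-update 0 2) (t′-update 1 1)))
                (cong (_+ m) (t′-update 0 1)))
             (λ a b → cong (λ z → (c ⊛ e₂*_ ^[ suc r ] z) a b) (fold-+ 𝟙 e₁*_ s)))

  1≤c : 1 ≤ c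
  1≤c = m^n>0 2 (t 1 1)

  centreLeaf-schurPositive : ∀ e → SchurPositive (centreLeaf 1 e Lα ⊕ centreLeaf 0 e Lβ)
  centreLeaf-schurPositive 0 = SchurPositive-resp (≈-sym chain)
    (eMul-schurPositive r s (e₂-schurPositive (powerPoly-schurPositive m 1≤c)))
    where
    open ≈-Reasoning
    chain : centreLeaf 1 0 Lα ⊕ centreLeaf 0 0 Lβ ≈ E (e₂* powerPoly m c)
    chain = begin
      centreLeaf 1 0 Lα ⊕ centreLeaf 0 0 Lβ
        ≈⟨ ⊕-cong (centreLeaf-1-0 Lα) (centreLeaf-0-0 Lβ) ⟩
      x₁* Lα only₁ ⊕ x₂* Lα only₂ ⊕ Lβ none
        ≈⟨ ⊕-cong (⊕-cong (resp-≈ x₁-isMultiplier Lα-only₁) (resp-≈ x₂-isMultiplier Lα-only₂)) Lβ-none ⟩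
      x₁* E (x₂*_ ^[ suc m ] 𝟙) ⊕ x₂* E (x₁*_ ^[ suc m ] 𝟙) ⊕ c ⊛ e₂* E (e₁*_ ^[ m ] 𝟙)
        ≈⟨ ⊕-cong (⊕-cong (x₁-comm E-isMultiplier _)
                           (≈-trans (resp-≈ E-isMultiplier (x₁x₂-comm _)) (x₂-comm E-isMultiplier _))) ≈-refl ⟨
      E (e₂* x₂*_ ^[ m ] 𝟙) ⊕ E (e₂* x₁*_ ^[ m ] 𝟙) ⊕ c ⊛ e₂* E (e₁*_ ^[ m ] 𝟙)
        ≈⟨ eMul-e₂-powerPoly r s m c ⟩
      E (e₂* powerPoly m c) ∎
  centreLeaf-schurPositive 1 = SchurPositive-resp (≈-sym chain)
    (eMul-schurPositive r s (e₂-schurPositive (powerPoly-schurPositive (suc m) 1≤c)))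
    where
    open ≈-Reasoning
    g : Poly
    g = e₁*_ ^[ m ] 𝟙
    e₁-inward : e₁* (c ⊛ e₂* E g) ≈ c ⊛ e₂* E (e₁* g)
    e₁-inward = ≈-trans (⊛-homo e₁-isMultiplier c _)
      (resp-≈ (⊛-isMultiplier c) (≈-trans (≈-sym (e₁-comm e₂-isMultiplier _))
                                          (resp-≈ e₂-isMultiplier (≈-sym (e₁-comm E-isMultiplier g)))))
    chain : centreLeaf 1 1 Lα ⊕ centreLeaf 0 1 Lβ ≈ E (e₂* powerPoly (suc m) c)
    chain = begin
      centreLeaf 1 1 Lα ⊕ centreLeaf 0 1 Lβ
        ≈⟨ ⊕-cong (centreLeaf-1-1 Lα) (centreLeaf-0-1 Lβ) ⟩
      e₂* Lα only₁ ⊕ x₂* x₁* Lα only₂ ⊕ e₁* Lβ none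
        ≈⟨ ⊕-cong (⊕-cong (resp-≈ e₂-isMultiplier Lα-only₁)
                           (resp-≈ (∘-isMultiplier x₂-isMultiplier x₁-isMultiplier) Lα-only₂))
                  (resp-≈ e₁-isMultiplier Lβ-none) ⟩
      e₂* E (x₂*_ ^[ suc m ] 𝟙) ⊕ x₂* x₁* E (x₁*_ ^[ suc m ] 𝟙) ⊕ e₁* (c ⊛ e₂* E g)
        ≈⟨ ⊕-cong (⊕-cong (≈-sym (e₂-comm E-isMultiplier _))
                           (≈-trans (≈-sym (x₁x₂-comm _)) (≈-sym (e₂-comm E-isMultiplier _)))) e₁-inward ⟩
      E (e₂* x₂*_ ^[ suc m ] 𝟙) ⊕ E (e₂* x₁*_ ^[ suc m ] 𝟙) ⊕ c ⊛ e₂* E (e₁* g)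
        ≈⟨ eMul-e₂-powerPoly r s (suc m) c ⟩
      E (e₂* powerPoly (suc m) c) ∎
  centreLeaf-schurPositive 2 = SchurPositive-resp (≈-sym chain)
    (e₂-schurPositive (⊛-schurPositive c (e₂-schurPositive
      (eMul-schurPositive r s (^-schurPositive e₁-schurPositive m 𝟙-schurPositive)))))
    where
    chain : centreLeaf 1 2 Lα ⊕ centreLeaf 0 2 Lβ ≈ e₂* (c ⊛ e₂* E (e₁*_ ^[ m ] 𝟙))
    chain = ⊕-cong (centreLeaf-1-2+ 0 Lα) (≈-trans (centreLeaf-0-2 Lβ) (resp-≈ e₂-isMultiplier Lβ-none))
  centreLeaf-schurPositive (suc (suc (suc e))) =
    SchurPositive-resp (≈-sym chain) (⊛-schurPositive 0 𝟙-schurPositive)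
    where
    chain : centreLeaf 1 (3 + e) Lα ⊕ centreLeaf 0 (3 + e) Lβ ≈ 0 ⊛ 𝟙
    chain = ⊕-cong (centreLeaf-1-2+ (suc e) Lα) (centreLeaf-0-3+ e Lβ)

  sum-schurPositive : SchurPositive (spiderX n α ⊕ spiderX n β)
  sum-schurPositive = SchurPositive-resp
    (≈-sym (⊕-cong (≈-trans (spiderX-decomposition n α) (≈-reindex (λ p → centreLeaf p (α v1) Lα) centre))
                   (spiderX-decomposition n β)))
    (centreLeaf-schurPositive (α v1))

0≤[i-j]+[k-l] : ∀ {i j k l} → j + l ≤ i + k →
                ℤ.0ℤ ℤ.≤ (ℤ.+ i ℤ.- ℤ.+ j) ℤ.+ (ℤ.+ k ℤ.- ℤ.+ l)
0≤[i-j]+[k-l] {i} {j} {k} {l} h = subst (ℤ.0ℤ ℤ.≤_) (sym regroup) (ℤ.i≤j⇒0≤j-i (ℤ.+≤+ h))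
  where
  regroup : (ℤ.+ i ℤ.- ℤ.+ j) ℤ.+ (ℤ.+ k ℤ.- ℤ.+ l)
          ≡ (ℤ.+ i ℤ.+ ℤ.+ k) ℤ.- (ℤ.+ j ℤ.+ ℤ.+ l)
  regroup = trans
    (CommSemigroupProperties.interchange ℤ.+-commutativeSemigroup (ℤ.+ i) (ℤ.- ℤ.+ j) (ℤ.+ k) (ℤ.- ℤ.+ l))
    (cong (λ z → (ℤ.+ i ℤ.+ ℤ.+ k) ℤ.+ z) (sym (ℤ.neg-distrib-+ (ℤ.+ j) (ℤ.+ l))))

schurPositive⇒SumGe2s : ∀ n (γ δ : SV n → ℕ) → SchurPositive (spiderX n γ ⊕ spiderX n δ) →
                        SumGe2s (spider1 n) (onSpider n γ) (onSpider n δ)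
schurPositive⇒SumGe2s n γ δ sp a zero    _   = ℤ.+≤+ z≤n
schurPositive⇒SumGe2s n γ δ sp a (suc b) b<a =
  0≤[i-j]+[k-l] {spiderX n γ a (suc b)} {spiderX n γ (suc a) b}
                {spiderX n δ a (suc b)} {spiderX n δ (suc a) b} (dominance sp a b b<a)

proposition3p17 : (n : ℕ) → 1 ≤ n → (α : SV n → ℕ) → (k : ℕ) → 2 ≤ k → InA n α k →
    (j : ℕ) → 1 ≤ j → j ≤ k →
    SumGe2s (spider1 n) (onSpider n α) (onSpider n (phiExt n α j))
proposition3p17 n _ α k _ α∈𝒜ₖ j 1≤j j≤k =
  schurPositive⇒SumGe2s n α (phiExt n α j) (SpecialLeg.sum-schurPositive α∈𝒜ₖ 1≤j j≤k)
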